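{- Suppose $P\stackrel{2}{\to}Q$ (so $P$ and $Q$ have the same parity). If $P$ and $Q$ are even, then $Q$ U2 implies $P$ U2, and $Q$ K2 implies $P$ K2. If $P$ and $Q$ are odd, then $Q$ U1 implies $P$ U1, and $Q$ K1 implies $P$ K1.
   Context: A knot pseudodiagram is a knot projection in which each crossing is resolved or unresolved, taken up to planar isotopy and Reidemeister moves. In the knotting-unknotting game the Knotter and Unknotter alternately resolve one unresolved crossing; when none remain, the Unknotter wins iff the knot is the unknot. A position is U1 (resp. K1) if the Unknotter (resp. Knotter) can force a win moving first, U2 (resp. K2) if moving second. A pseudodiagram is even/odd according to the parity of its number of unresolved crossings. $P\stackrel{2}{\to}Q$ (pseudo Reidemeister II move) means $Q$ is obtained from $P$ by a Reidemeister II move removing two unresolved crossings forming a bigon between two strands. -}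

module Defs where

-- Knot (pseudo)diagrams as planar 4-valent combinatorial maps.
--
-- A diagram with n crossings has darts (half-edges) (v , k), v : Fin n the
-- crossing, k : Fin 4 the position in the COUNTERCLOCKWISE cyclic order
-- around v.  The two strands through v are the dart pairs {0,2} and {1,3}.
-- α pairs darts into edges.
-- The diagram with 0 crossings is the round circle (trivial diagram).

open import Level using (0ℓ)
open import Data.Nat using (ℕ; zero; suc; _+_; _*_; _≤ᵇ_; _%_)
open import Data.Fin using (Fin; zero; suc; toℕ; _↑ʳ_; _↑ˡ_; splitAt; _≟_)
open import Data.Fin.Permutation using (Permutation′; _⟨$⟩ʳ_)
open import Data.Bool using (Bool; true; false; not; _xor_; if_then_else_; _∧_)
open import Data.Product using (Σ; ∃; ∃-syntax; _×_; _,_; proj₁; proj₂)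
open import Data.Sum using (_⊎_; inj₁; inj₂)
open import Data.List using (List; []; _∷_; map; concatMap; upTo; allFin)
open import Data.Unit using (⊤)
open import Relation.Nullary using (¬_)
open import Relation.Nullary.Decidable using (⌊_⌋)
open import Relation.Binary.PropositionalEquality using (_≡_)
open import Relation.Binary.Construct.Closure.Equivalence using (EqClosure)

data State : Set where
  unres : State
  -- res true  : the strand through positions 0,2 passes over
  -- res false : the strand through positions 1,3 passes over
  res   : Bool → State

p0 p1 p2 p3 : Fin 4
p0 = zero
p1 = suc zero
p2 = suc (suc zero)
p3 = suc (suc (suc zero))

rot1 : Fin 4 → Fin 4
rot1 zero = p1
rot1 (suc zero) = p2
rot1 (suc (suc zero)) = p3
rot1 (suc (suc (suc zero))) = p0

rotBy : ℕ → Fin 4 → Fin 4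
rotBy zero k = k
rotBy (suc r) k = rot1 (rotBy r k)

oddF : Fin 4 → Bool
oddF zero = false
oddF (suc zero) = true
oddF (suc (suc zero)) = false
oddF (suc (suc (suc zero))) = true

Dart : ℕ → Set
Dart n = Fin n × Fin 4

record Diagram (n : ℕ) : Set where
  field
    α  : Dart n → Dart n
    st : Fin n → State
open Diagram public

iter : {A : Set} → ℕ → (A → A) → A → A
iter zero f x = x
iter (suc j) f x = f (iter j f x)

σ : ∀ {n} → Dart n → Dart n
σ (v , k) = v , rot1 k

opp : ∀ {n} → Dart n → Dart n
opp (v , k) = v , rotBy 2 k

countB : {A : Set} → (A → Bool) → List A → ℕ
countB f [] = 0
countB f (x ∷ xs) = if f x then suc (countB f xs) else countB f xs

allB : {A : Set} → (A → Bool) → List A → Bool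
allB f [] = true
allB f (x ∷ xs) = f x ∧ allB f xs

darts : ∀ n → List (Dart n)
darts n = concatMap (λ v → map (λ k → (v , k)) (allFin 4)) (allFin n)

idx : ∀ {n} → Dart n → ℕ
idx (v , k) = toℕ v * 4 + toℕ k

-- Well-formedness: α a fixed-point-free involution, one component (knot),
-- genus 0 (V - E + F = 2 with V = n, E = 2n, so F = n + 2 faces, the
-- faces being the orbits of σ ∘ α).

module _ {n : ℕ} (D : Diagram n) where
  strandStep : Dart n → Dart n
  strandStep d = opp (α D d)

  faceStep : Dart n → Dart n
  faceStep d = σ (α D d)

  isFaceRep : Dart n → Bool
  isFaceRep d = allB (λ j → idx d ≤ᵇ idx (iter j faceStep d)) (upTo (4 * n))

  faceCount : ℕ
  faceCount = countB isFaceRep (darts n)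

  IsKnot : Set
  IsKnot = ∀ d e → ∃[ j ] (iter j strandStep d ≡ e ⊎ iter j strandStep d ≡ α D e)

Planar : ∀ {n} → Diagram n → Set
Planar {zero} D = ⊤
Planar {suc n} D = faceCount D ≡ suc n + 2

WF : ∀ {n} → Diagram n → Set
WF D = (∀ d → α D (α D d) ≡ d) × (∀ d → ¬ (α D d ≡ d)) × IsKnot D × Planar D

O : Diagram 0
O = record { α = λ { (() , _) } ; st = λ () }

-- Planar isotopy (orientation-preserving isomorphism of maps on S²)

rotSt : Fin 4 → State → State
rotSt r unres = unres
rotSt r (res b) = res (b xor oddF r)

record Iso {n : ℕ} (D D' : Diagram n) : Set where
  field
    π   : Permutation′ n
    rot : Fin n → Fin 4
  mapD : Dart n → Dart n
  mapD (v , k) = (π ⟨$⟩ʳ v , rotBy (toℕ (rot v)) k)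
  field
    α-hom  : ∀ d → α D' (mapD d) ≡ mapD (α D d)
    st-hom : ∀ v → st D' (π ⟨$⟩ʳ v) ≡ rotSt (rot v) (st D v)

-- Removing a gadget on the first k crossings.  The outer darts of the
-- gadget are paired by `p` (the two ends of each strand through the
-- gadget); the outside edges at paired outer darts are glued together.

module _ {k n : ℕ} where
  isOut : Dart (k + n) → Bool
  isOut (v , _) with splitAt k v
  ... | inj₁ _ = false
  ... | inj₂ _ = true

  liftG : (Fin k × Fin 4 → Fin k × Fin 4) → Dart (k + n) → Dart (k + n)
  liftG p (v , i) with splitAt k v
  ... | inj₁ g = (proj₁ (p (g , i)) ↑ˡ n , proj₂ (p (g , i)))
  ... | inj₂ _ = (v , i)

  embD : Dart n → Dart (k + n)
  embD (v , i) = (k ↑ʳ v , i)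

  reroute : (Dart (k + n) → Dart (k + n)) → (Dart (k + n) → Dart (k + n))
            → Dart (k + n) → Dart (k + n)
  reroute p a e =
    if isOut e then e
    else (if isOut (a (p e)) then a (p e) else a (p (a (p e))))

  RemoveGadget : (Fin k × Fin 4 → Fin k × Fin 4) → Diagram (k + n) → Diagram n → Set
  RemoveGadget p D D' =
    (∀ d → embD (α D' d) ≡ reroute (liftG p) (α D) (α D (embD d)))
    × (∀ v → st D' v ≡ st D (k ↑ʳ v))

partnerR1 : Fin 1 × Fin 4 → Fin 1 × Fin 4
partnerR1 (g , suc (suc zero)) = (g , p3)
partnerR1 (g , suc (suc (suc zero))) = (g , p2)
partnerR1 x = x

g0 : Fin 2
g0 = zero
g1 : Fin 2
g1 = suc zero

partnerR2 : Fin 2 × Fin 4 → Fin 2 × Fin 4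
partnerR2 (zero , suc (suc zero)) = (g1 , p3)
partnerR2 (zero , suc (suc (suc zero))) = (g1 , p2)
partnerR2 (suc zero , suc (suc zero)) = (g0 , p3)
partnerR2 (suc zero , suc (suc (suc zero))) = (g0 , p2)
partnerR2 x = x

-- Normalised Reidemeister moves (general position up to Iso).

IsResolved : State → Set
IsResolved s = ∃[ b ] (s ≡ res b)

-- R1: crossing 0 is a curl (monogon between positions 0 and 1).
R1 : ∀ {n} → Diagram (1 + n) → Diagram n → Set
R1 D D' = α D (zero , p0) ≡ (zero , p1) × IsResolved (st D zero)
          × RemoveGadget partnerR1 D D'

-- bigon between crossings 0 and 1: edges (0,p0)-(1,p1) and (0,p1)-(1,p0);
-- strand A uses positions {0,2} at 0 and {1,3} at 1.
Bigon : ∀ {n} → Diagram (2 + n) → Set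
Bigon D = α D (zero , p0) ≡ (suc zero , p1) × α D (zero , p1) ≡ (suc zero , p0)

-- classical R2: the same strand is over at both crossings
R2 : ∀ {n} → Diagram (2 + n) → Diagram n → Set
R2 D D' = Bigon D
          × ((st D zero ≡ res true × st D (suc zero) ≡ res false)
             ⊎ (st D zero ≡ res false × st D (suc zero) ≡ res true))
          × RemoveGadget partnerR2 D D'

PR2 : ∀ {n} → Diagram (2 + n) → Diagram n → Set
PR2 D D' = Bigon D × st D zero ≡ unres × st D (suc zero) ≡ unres
           × RemoveGadget partnerR2 D D'

-- R3: triangle face on crossings 0,1,2; the new diagram glues each
-- outside edge to the other end of its strand through the triangle
-- (the half-turn of the triangle tangle), with the same crossing states.
t0 t1 t2 : ∀ {n} → Fin (3 + n)
t0 = zero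
t1 = suc zero
t2 = suc (suc zero)

ρ3 : ∀ {n} → Dart (3 + n) → Dart (3 + n)
ρ3 (zero , suc (suc zero)) = (t2 , p3)
ρ3 (suc (suc zero) , suc (suc (suc zero))) = (t0 , p2)
ρ3 (zero , suc (suc (suc zero))) = (t1 , p2)
ρ3 (suc zero , suc (suc zero)) = (t0 , p3)
ρ3 (suc (suc zero) , suc (suc zero)) = (t1 , p3)
ρ3 (suc zero , suc (suc (suc zero))) = (t2 , p2)
ρ3 d = d

R3 : ∀ {n} → Diagram (3 + n) → Diagram (3 + n) → Set
R3 D D' = α D (t0 , p1) ≡ (t1 , p0) × α D (t1 , p1) ≡ (t2 , p0)
          × α D (t2 , p1) ≡ (t0 , p0)
          × (∃[ x0 ] ∃[ x1 ] ∃[ x2 ] (st D t0 ≡ res x0 × st D t1 ≡ res x1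
               × st D t2 ≡ res x2 × ¬ (x0 ≡ x1 × x1 ≡ x2)))
          × (∀ d → α D' d ≡ ρ3 (α D (ρ3 d)))
          × (∀ v → st D' v ≡ st D v)

AnyDiagram : Set
AnyDiagram = Σ ℕ Diagram

data Step : AnyDiagram → AnyDiagram → Set where
  iso : ∀ {n} {D D' : Diagram n} → WF D → WF D' → Iso D D' → Step (n , D) (n , D')
  r1  : ∀ {n} {D : Diagram (1 + n)} {D' : Diagram n} → WF D → WF D' → R1 D D'
        → Step (1 + n , D) (n , D')
  r2  : ∀ {n} {D : Diagram (2 + n)} {D' : Diagram n} → WF D → WF D' → R2 D D'
        → Step (2 + n , D) (n , D')
  r3  : ∀ {n} {D D' : Diagram (3 + n)} → WF D → WF D' → R3 D D'
        → Step (3 + n , D) (3 + n , D')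

AllResolved : ∀ {n} → Diagram n → Set
AllResolved {n} D = ∀ v → IsResolved (st D v)

IsUnknot : ∀ {n} → Diagram n → Set
IsUnknot {n} D = AllResolved D × EqClosure Step (n , D) (0 , O)

resolve : ∀ {n} → Diagram n → Fin n → Bool → Diagram n
resolve D v b = record D { st = λ w → if ⌊ w ≟ v ⌋ then res b else st D w }

HasUnresolved : ∀ {n} → Diagram n → Set
HasUnresolved D = ∃[ v ] (st D v ≡ unres)

data Player : Set where
  unknotter knotter : Player

-- UWins p D : the Unknotter can force a win from D when p is to move.
data UWins {n : ℕ} : Player → Diagram n → Set where
  done  : ∀ {p D} → AllResolved D → IsUnknot D → UWins p D
  uMove : ∀ {D} v b → st D v ≡ unres → UWins knotter (resolve D v b)
          → UWins unknotter D
  kMove : ∀ {D} → HasUnresolved D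
          → (∀ v b → st D v ≡ unres → UWins unknotter (resolve D v b))
          → UWins knotter D

data KWins {n : ℕ} : Player → Diagram n → Set where
  done  : ∀ {p D} → AllResolved D → ¬ IsUnknot D → KWins p D
  kMove : ∀ {D} v b → st D v ≡ unres → KWins unknotter (resolve D v b)
          → KWins knotter D
  uMove : ∀ {D} → HasUnresolved D
          → (∀ v b → st D v ≡ unres → KWins knotter (resolve D v b))
          → KWins unknotter D

U1 U2 K1 K2 : ∀ {n} → Diagram n → Set
U1 D = UWins unknotter D
U2 D = UWins knotter D
K1 D = KWins knotter D
K2 D = KWins unknotter D

isUnres : State → Bool
isUnres unres = true
isUnres (res _) = false

unresCount : ∀ {n} → Diagram n → ℕ
unresCount {n} D = countB (λ v → isUnres (st D v)) (allFin n)

Even Odd : ∀ {n} → Diagram n → Set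
Even D = unresCount D % 2 ≡ 0
Odd D = unresCount D % 2 ≡ 1

_⟶²_ : ∀ {n} → Diagram (2 + n) → Diagram n → Set
_⟶²_ {n} P Q = WF P × WF Q
  × Σ (Diagram (2 + n)) (λ P₀ → Σ (Diagram n) (λ Q₀ →
      Iso P P₀ × PR2 P₀ Q₀ × Iso Q₀ Q))

module Submission where

-- Across the bigon (open-UWins, open-KWins) the winner copies her strategy
-- outside it and answers a move inside by resolving the other bigon crossing
-- oppositely, leaving a classical Reidemeister II bigon (closed-UWins,
-- closed-KWins); the parity of Q (EvenTurn) ensures that it is the opponent
-- who must open the bigon once play on Q is over.

open import Defs
open import Data.Nat using (ℕ; zero; suc; _+_; _*_; _∸_; _≤_; _<_; _≤ᵇ_; _%_; _/_; z≤n; s≤s; s≤s⁻¹)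
open import Data.Nat.Properties
  using (≤-antisym; ≤-trans; <-≤-trans; <⇒≤; +-suc; +-comm; *-comm; *-suc; suc-injective; ≤ᵇ⇒≤; ≤⇒≤ᵇ;
         n<1+n; m∸n≤m; m<n⇒0<n∸m; m+[n∸m]≡n)
open import Data.Nat.DivMod using (m≡m%n+[m/n]*n; m%n<n)
open import Data.Fin using (Fin; zero; suc; toℕ; combine; _≟_)
open import Data.Fin.Properties using (pigeonhole; toℕ<n; toℕ-injective; toℕ-combine; combine-injective)
open import Data.Bool using (Bool; true; false; not; _∧_; _xor_; if_then_else_)
open import Data.Product using (∃-syntax; _×_; _,_; proj₁; proj₂)
open import Data.List using (List; []; _∷_; map; concatMap; _++_; allFin; tabulate; applyUpTo; upTo)
open import Data.List.Extrema.Nat using (argmin; argmin-all; f[argmin]≤f[xs])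
open import Data.List.Relation.Unary.All.Properties using (applyUpTo⁺₂; applyUpTo⁻)
open import Function.Bundles using (Equivalence)
open import Data.Fin.Permutation using (_⟨$⟩ʳ_; _⟨$⟩ˡ_; inverseˡ; inverseʳ)
open import Data.Bool.Properties using (T-≡; not-involutive; xor-assoc; xor-same; xor-identityʳ; ∧-zeroʳ; ∧-identityʳ; ∧-conicalˡ; ∧-conicalʳ)
open import Data.List.Properties using (map-tabulate)
open import Data.Empty using (⊥; ⊥-elim)
open import Data.Unit using (tt)
open import Data.Sum using (_⊎_; inj₁; inj₂)
open import Relation.Binary.Construct.Closure.Symmetric using (fwd; bwd)
open import Relation.Binary.Construct.Closure.ReflexiveTransitive using (_◅_)
open import Relation.Nullary using (¬_; yes; no)
open import Relation.Nullary.Decidable using (⌊_⌋)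
open import Relation.Binary.PropositionalEquality
  using (_≡_; refl; sym; trans; cong; cong₂; subst; subst₂; module ≡-Reasoning)

countB-ext : {A : Set} {p q : A → Bool} (xs : List A) →
  (∀ x → p x ≡ q x) → countB p xs ≡ countB q xs
countB-ext [] e = refl
countB-ext {p = p} {q} (x ∷ xs) e with p x | q x | e x
... | true  | true  | refl = cong suc (countB-ext xs e)
... | false | false | refl = countB-ext xs e

countB-none : {A : Set} {p : A → Bool} (xs : List A) →
  (∀ x → p x ≡ false) → countB p xs ≡ 0
countB-none [] e = refl
countB-none {p = p} (x ∷ xs) e with p x | e x
... | false | refl = countB-none xs e

countB-witness : {A : Set} {p : A → Bool} (xs : List A) {k : ℕ} →
  countB p xs ≡ suc k → ∃[ x ] (p x ≡ true)
countB-witness {p = p} (x ∷ xs) e with p x in px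
... | true  = x , px
... | false = countB-witness xs e

countB-split : {A : Set} (p q : A → Bool) (xs : List A) →
  countB p xs ≡ countB (λ x → p x ∧ q x) xs + countB (λ x → p x ∧ not (q x)) xs
countB-split p q [] = refl
countB-split p q (x ∷ xs) with p x | q x
... | true  | true  = cong suc (countB-split p q xs)
... | true  | false = trans (cong suc (countB-split p q xs)) (sym (+-suc _ _))
... | false | _     = countB-split p q xs

countB-++ : {A : Set} (p : A → Bool) (xs ys : List A) →
  countB p (xs ++ ys) ≡ countB p xs + countB p ys
countB-++ p [] ys = refl
countB-++ p (x ∷ xs) ys with p x
... | true  = cong suc (countB-++ p xs ys)
... | false = countB-++ p xs ys

countB-map : {A B : Set} (p : B → Bool) (g : A → B) (xs : List A) →
  countB p (map g xs) ≡ countB (λ x → p (g x)) xs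
countB-map p g [] = refl
countB-map p g (x ∷ xs) with p (g x)
... | true  = cong suc (countB-map p g xs)
... | false = countB-map p g xs

countB-× : {A B : Set} (p : A → Bool) (q : B → Bool) (xs : List A) (ys : List B) →
  countB (λ z → p (proj₁ z) ∧ q (proj₂ z)) (concatMap (λ a → map (a ,_) ys) xs)
    ≡ countB p xs * countB q ys
countB-× p q [] ys = refl
countB-× {A} {B} p q (x ∷ xs) ys = begin
  countB r (map (x ,_) ys ++ concatMap (λ a → map (a ,_) ys) xs)
    ≡⟨ countB-++ r (map (x ,_) ys) _ ⟩
  countB r (map (x ,_) ys) + countB r (concatMap (λ a → map (a ,_) ys) xs)
    ≡⟨ cong₂ _+_ (trans (countB-map r (x ,_) ys) (row (p x))) (countB-× p q xs ys) ⟩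
  (if p x then countB q ys else 0) + countB p xs * countB q ys
    ≡⟨ add-row (p x) ⟩
  countB p (x ∷ xs) * countB q ys ∎
  where
  open ≡-Reasoning
  r : A × B → Bool
  r z = p (proj₁ z) ∧ q (proj₂ z)
  row : ∀ b → countB (λ y → b ∧ q y) ys ≡ (if b then countB q ys else 0)
  row true  = refl
  row false = countB-none ys (λ _ → refl)
  add-row : ∀ b → (if b then countB q ys else 0) + countB p xs * countB q ys
                  ≡ (if b then suc (countB p xs) else countB p xs) * countB q ys
  add-row true  = refl
  add-row false = refl

record Listing (A : Set) : Set where
  field
    _==_     : A → A → Bool
    ==-sound : ∀ x y → x == y ≡ true → x ≡ y
    ==-refl  : ∀ x → x == x ≡ true
    elems    : List A
    once     : ∀ y → countB (_== y) elems ≡ 1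
open Listing

module _ {A : Set} (L : Listing A) where

  countB-remove : (q : A → Bool) (y : A) → q y ≡ true →
    countB q (elems L) ≡ suc (countB (λ z → q z ∧ not (_==_ L z y)) (elems L))
  countB-remove q y qy =
    trans (countB-split q (λ z → _==_ L z y) (elems L))
          (cong (_+ countB (λ z → q z ∧ not (_==_ L z y)) (elems L))
                (trans (countB-ext (elems L) only-y) (once L y)))
    where
    only-y : ∀ z → (q z ∧ _==_ L z y) ≡ _==_ L z y
    only-y z with _==_ L z y in e
    ... | false = ∧-zeroʳ (q z)
    ... | true rewrite ==-sound L z y e = cong (_∧ true) qy

-- An injection φ of the p-elements into the q-elements bounds their counts:
-- remove a p-element x and its image φ x, and recurse.
countB-injection : {A B : Set} (LA : Listing A) (LB : Listing B) (φ : A → B) →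
  ∀ k (p : A → Bool) (q : B → Bool) → countB p (elems LA) ≡ k →
  (∀ x → p x ≡ true → q (φ x) ≡ true) →
  (∀ x x' → p x ≡ true → p x' ≡ true → φ x ≡ φ x' → x ≡ x') →
  k ≤ countB q (elems LB)
countB-injection LA LB φ zero    p q count pq inj = z≤n
countB-injection {A} {B} LA LB φ (suc k) p q count pq inj with countB-witness (elems LA) count
... | x , px = subst (suc k ≤_) (sym (countB-remove LB q (φ x) (pq x px)))
                 (s≤s (countB-injection LA LB φ k p' q' count' pq' inj'))
  where
  p' : A → Bool
  p' z = p z ∧ not (_==_ LA z x)
  q' : B → Bool
  q' w = q w ∧ not (_==_ LB w (φ x))
  count' : countB p' (elems LA) ≡ k
  count' = suc-injective (trans (sym (countB-remove LA p x px)) count)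
  x-removed : not (_==_ LA x x) ≡ true → ⊥
  x-removed e with trans (sym (cong not (==-refl LA x))) e
  ... | ()
  pq' : ∀ z → p' z ≡ true → q' (φ z) ≡ true
  pq' z h with _==_ LB (φ z) (φ x) in e
  ... | false = trans (∧-identityʳ _) (pq z (∧-conicalˡ _ _ h))
  ... | true with inj z x (∧-conicalˡ _ _ h) px (==-sound LB _ _ e)
  ...   | refl = ⊥-elim (x-removed (∧-conicalʳ _ _ h))
  inj' : ∀ z z' → p' z ≡ true → p' z' ≡ true → φ z ≡ φ z' → z ≡ z'
  inj' z z' h h' = inj z z' (∧-conicalˡ _ _ h) (∧-conicalˡ _ _ h')

countB-bijection : {A B : Set} (LA : Listing A) (LB : Listing B)
  (p : A → Bool) (q : B → Bool) (φ : A → B) (ψ : B → A) →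
  (∀ x → p x ≡ true → q (φ x) ≡ true) →
  (∀ x x' → p x ≡ true → p x' ≡ true → φ x ≡ φ x' → x ≡ x') →
  (∀ y → q y ≡ true → p (ψ y) ≡ true) →
  (∀ y y' → q y ≡ true → q y' ≡ true → ψ y ≡ ψ y' → y ≡ y') →
  countB p (elems LA) ≡ countB q (elems LB)
countB-bijection LA LB p q φ ψ pq φ-inj qp ψ-inj = ≤-antisym
  (countB-injection LA LB φ _ p q refl pq φ-inj) (countB-injection LB LA ψ _ q p refl qp ψ-inj)

countB-permute : {A : Set} (L : Listing A) (φ ψ : A → A) →
  (∀ x → ψ (φ x) ≡ x) → (∀ y → φ (ψ y) ≡ y) →
  (q : A → Bool) → countB (λ x → q (φ x)) (elems L) ≡ countB q (elems L)
countB-permute L φ ψ ψφ φψ q = countB-bijection L L (λ x → q (φ x)) q φ ψ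
  (λ x qφx → qφx)
  (λ x x' _ _ e → trans (sym (ψφ x)) (trans (cong ψ e) (ψφ x')))
  (λ y qy → subst (λ z → q z ≡ true) (sym (φψ y)) qy)
  (λ y y' _ _ e → trans (sym (φψ y)) (trans (cong φ e) (φψ y')))

≟-suc : ∀ {m} (i j : Fin m) → ⌊ suc i ≟ suc j ⌋ ≡ ⌊ i ≟ j ⌋
≟-suc i j with i ≟ j
... | yes _ = refl
... | no _  = refl

finListing : ∀ n → Listing (Fin n)
finListing n = record
  { _==_ = λ x y → ⌊ x ≟ y ⌋ ; ==-sound = sound ; ==-refl = reflexive
  ; elems = allFin n ; once = fin-once }
  where
  sound : ∀ {m} (x y : Fin m) → ⌊ x ≟ y ⌋ ≡ true → x ≡ y
  sound x y e with x ≟ y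
  ... | yes x≡y = x≡y
  reflexive : ∀ {m} (x : Fin m) → ⌊ x ≟ x ⌋ ≡ true
  reflexive x with x ≟ x
  ... | yes _ = refl
  ... | no x≢x = ⊥-elim (x≢x refl)
  countB-shift : ∀ {m} (p : Fin (suc m) → Bool) →
    countB p (tabulate suc) ≡ countB (λ i → p (suc i)) (allFin m)
  countB-shift {m} p = trans (cong (countB p) (sym (map-tabulate {n = m} (λ i → i) suc)))
                             (countB-map p suc (allFin m))
  fin-once : ∀ {m} (y : Fin m) → countB (λ z → ⌊ z ≟ y ⌋) (allFin m) ≡ 1
  fin-once {suc m} zero    =
    cong suc (trans (countB-shift {m} (λ z → ⌊ z ≟ zero ⌋)) (countB-none (allFin m) (λ _ → refl)))
  fin-once {suc m} (suc y) = trans (countB-shift {m} (λ z → ⌊ z ≟ suc y ⌋))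
                                   (trans (countB-ext (allFin m) (λ i → ≟-suc i y)) (fin-once y))

_×-listing_ : {A B : Set} → Listing A → Listing B → Listing (A × B)
LA ×-listing LB = record
  { _==_ = λ z w → _==_ LA (proj₁ z) (proj₁ w) ∧ _==_ LB (proj₂ z) (proj₂ w)
  ; ==-sound = λ { (a , b) (a' , b') e → cong₂ _,_ (==-sound LA a a' (∧-conicalˡ _ _ e))
                                                    (==-sound LB b b' (∧-conicalʳ _ _ e)) }
  ; ==-refl = λ { (a , b) → cong₂ _∧_ (==-refl LA a) (==-refl LB b) }
  ; elems = concatMap (λ a → map (a ,_) (elems LB)) (elems LA)
  ; once = λ { (a , b) → trans (countB-× _ _ (elems LA) (elems LB))
                                (cong₂ _*_ (once LA a) (once LB b)) } }

-- the darts of a diagram, listed in the order of `darts`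
dartListing : ∀ n → Listing (Dart n)
dartListing n = finListing n ×-listing finListing 4

iter-+ : {A : Set} (f : A → A) (a b : ℕ) (x : A) → iter (a + b) f x ≡ iter a f (iter b f x)
iter-+ f zero    b x = refl
iter-+ f (suc a) b x = cong f (iter-+ f a b x)

iter-conj : {A B : Set} {f : A → A} {f' : B → B} (h : A → B) →
  (∀ x → h (f x) ≡ f' (h x)) → ∀ j x → h (iter j f x) ≡ iter j f' (h x)
iter-conj {f' = f'} h comm zero    x = refl
iter-conj {f' = f'} h comm (suc j) x = trans (comm _) (cong f' (iter-conj h comm j x))

iter-injective : {A : Set} (f : A → A) → (∀ x y → f x ≡ f y → x ≡ y) →
  ∀ a x y → iter a f x ≡ iter a f y → x ≡ y
iter-injective f f-inj zero    x y e = e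
iter-injective f f-inj (suc a) x y e = iter-injective f f-inj a x y (f-inj _ _ e)

iter-period : {A : Set} (f : A → A) (p : ℕ) {x : A} → iter p f x ≡ x →
  ∀ a → iter (a * p) f x ≡ x
iter-period f p e zero    = refl
iter-period f p {x} e (suc a) = trans (iter-+ f p (a * p) x)
  (trans (cong (iter p f) (iter-period f p e a)) e)

-- Under an injective self-map of a type coded injectively into Fin m, every
-- point is periodic with period at most m (pigeonhole on its first m+1 iterates).
periodic : {A : Set} {m : ℕ} (code : A → Fin m) → (∀ x y → code x ≡ code y → x ≡ y) →
  (f : A → A) → (∀ x y → f x ≡ f y → x ≡ y) →
  ∀ d → ∃[ p ] (1 ≤ p × p ≤ m × iter p f d ≡ d)
periodic {m = m} code code-inj f f-inj d
  with pigeonhole (n<1+n m) (λ i → code (iter (toℕ i) f d))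
... | i , j , i<j , same-code =
  toℕ j ∸ toℕ i , m<n⇒0<n∸m i<j , ≤-trans (m∸n≤m (toℕ j) (toℕ i)) (s≤s⁻¹ (toℕ<n j)) , returns
  where
  open ≡-Reasoning
  returns : iter (toℕ j ∸ toℕ i) f d ≡ d
  returns = sym (iter-injective f f-inj (toℕ i) d _ (begin
    iter (toℕ i) f d                         ≡⟨ code-inj _ _ same-code ⟩
    iter (toℕ j) f d                         ≡⟨ cong (λ k → iter k f d) (sym (m+[n∸m]≡n (<⇒≤ i<j))) ⟩
    iter (toℕ i + (toℕ j ∸ toℕ i)) f d       ≡⟨ iter-+ f (toℕ i) (toℕ j ∸ toℕ i) d ⟩
    iter (toℕ i) f (iter (toℕ j ∸ toℕ i) f d) ∎))

allB-applyUpTo⁻ : (g : ℕ → Bool) (h : ℕ → ℕ) (M : ℕ) →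
  allB g (applyUpTo h M) ≡ true → ∀ {j} → j < M → g (h j) ≡ true
allB-applyUpTo⁻ g h (suc M) e {zero}  _       = ∧-conicalˡ _ _ e
allB-applyUpTo⁻ g h (suc M) e {suc j} (s≤s j<M) =
  allB-applyUpTo⁻ g (λ i → h (suc i)) M (∧-conicalʳ _ _ e) j<M

allB-applyUpTo⁺ : (g : ℕ → Bool) (h : ℕ → ℕ) (M : ℕ) →
  (∀ j → g (h j) ≡ true) → allB g (applyUpTo h M) ≡ true
allB-applyUpTo⁺ g h zero    all = refl
allB-applyUpTo⁺ g h (suc M) all =
  cong₂ _∧_ (all 0) (allB-applyUpTo⁺ g (λ i → h (suc i)) M (λ j → all (suc j)))

-- For a key k : A → ℕ, a k-representative is a point minimising k on its
-- orbit; for injective keys there is exactly one per orbit, so the number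
-- of representatives (the number of orbits) does not depend on the key.
module Orbits {A : Set} (f : A → A) (M : ℕ)
  (period : ∀ d → ∃[ p ] (1 ≤ p × p ≤ M × iter p f d ≡ d)) where

  _↝_ : A → A → Set
  x ↝ y = ∃[ a ] (iter a f x ≡ y)

  ↝-trans : ∀ {x y z} → x ↝ y → y ↝ z → x ↝ z
  ↝-trans {x} (a , refl) (b , refl) = b + a , iter-+ f b a x

  -- orbits are cycles, so lying on a common orbit is symmetric
  ↝-sym : ∀ {x y} → x ↝ y → y ↝ x
  ↝-sym {x} (a , refl) with period x
  ... | suc q , _ , _ , back = a * q , (begin
    iter (a * q) f (iter a f x) ≡⟨ iter-+ f (a * q) a x ⟨
    iter (a * q + a) f x        ≡⟨ cong (λ k → iter k f x) (trans (+-comm (a * q) a) (sym (*-suc a q))) ⟩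
    iter (a * suc q) f x        ≡⟨ iter-period f (suc q) back a ⟩
    x                           ∎)
    where open ≡-Reasoning

  within-M : ∀ d j → ∃[ j' ] (j' < M × iter j f d ≡ iter j' f d)
  within-M d j with period d
  ... | suc q , _ , p≤M , back = j % p , <-≤-trans (m%n<n j p) p≤M , (begin
    iter j f d                          ≡⟨ cong (λ k → iter k f d) (m≡m%n+[m/n]*n j p) ⟩
    iter (j % p + j / p * p) f d        ≡⟨ iter-+ f (j % p) (j / p * p) d ⟩
    iter (j % p) f (iter (j / p * p) f d) ≡⟨ cong (iter (j % p) f) (iter-period f p back (j / p)) ⟩
    iter (j % p) f d                    ∎)
    where
    open ≡-Reasoning
    p : ℕ
    p = suc q

  -- d is a k-representative: k is minimal at d among its first M iterates,
  -- i.e. on its orbit.  For the face map and k = idx this is isFaceRep.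
  isRep : (A → ℕ) → A → Bool
  isRep k d = allB (λ j → k d ≤ᵇ k (iter j f d)) (upTo M)

  isRep-min : ∀ k {x y} → isRep k x ≡ true → x ↝ y → k x ≤ k y
  isRep-min k {x} r (j , refl) with within-M x j
  ... | j' , j'<M , e = subst (λ z → k x ≤ k z) (sym e)
    (≤ᵇ⇒≤ _ _ (Equivalence.from T-≡ (allB-applyUpTo⁻ _ (λ i → i) M r j'<M)))

  isRep-intro : ∀ k x → (∀ j → k x ≤ k (iter j f x)) → isRep k x ≡ true
  isRep-intro k x min = allB-applyUpTo⁺ _ (λ i → i) M (λ j → Equivalence.to T-≡ (≤⇒≤ᵇ (min j)))

  canon : (A → ℕ) → A → A
  canon k d = argmin k d (applyUpTo (λ j → iter j f d) M)

  canon-↝ : ∀ k d → d ↝ canon k d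
  canon-↝ k d = argmin-all k {P = d ↝_} (0 , refl) (applyUpTo⁺₂ (λ j → iter j f d) M (λ j → j , refl))

  canon-isRep : ∀ k d → isRep k (canon k d) ≡ true
  canon-isRep k d with canon-↝ k d
  ... | a , e = isRep-intro k (canon k d) minimal
    where
    minimal : ∀ j → k (canon k d) ≤ k (iter j f (canon k d))
    minimal j with within-M d (j + a)
    ... | j' , j'<M , e' = subst (λ z → k (canon k d) ≤ k z)
      (trans (sym e') (trans (iter-+ f j a d) (cong (iter j f) e)))
      (applyUpTo⁻ (λ i → iter i f d) M (f[argmin]≤f[xs] {f = k} d _) j'<M)

  rep-unique : ∀ k → (∀ x y → k x ≡ k y → x ≡ y) →
    ∀ {x y} → isRep k x ≡ true → isRep k y ≡ true → x ↝ y → x ≡ y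
  rep-unique k k-inj rx ry x↝y =
    k-inj _ _ (≤-antisym (isRep-min k rx x↝y) (isRep-min k ry (↝-sym x↝y)))

  repCount : (L : Listing A) (k k' : A → ℕ) →
    (∀ x y → k x ≡ k y → x ≡ y) → (∀ x y → k' x ≡ k' y → x ≡ y) →
    countB (isRep k) (elems L) ≡ countB (isRep k') (elems L)
  repCount L k k' k-inj k'-inj = countB-bijection L L (isRep k) (isRep k') (canon k') (canon k)
    (λ x _ → canon-isRep k' x) (canon-injective k k' k-inj)
    (λ y _ → canon-isRep k y) (canon-injective k' k k'-inj)
    where
    canon-injective : ∀ k k' → (∀ x y → k x ≡ k y → x ≡ y) → ∀ x y →
      isRep k x ≡ true → isRep k y ≡ true → canon k' x ≡ canon k' y → x ≡ y
    canon-injective k k' k-inj x y rx ry e =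
      rep-unique k k-inj rx ry (↝-trans (canon-↝ k' x) (subst (_↝ y) (sym e) (↝-sym (canon-↝ k' y))))

rotBy-iter : ∀ r k → rotBy r k ≡ iter r rot1 k
rotBy-iter zero    k = refl
rotBy-iter (suc r) k = cong rot1 (rotBy-iter r k)

rot1-order4 : ∀ k → iter 4 rot1 k ≡ k
rot1-order4 zero                   = refl
rot1-order4 (suc zero)             = refl
rot1-order4 (suc (suc zero))       = refl
rot1-order4 (suc (suc (suc zero))) = refl

rotBy-comm : ∀ r s k → rotBy r (rotBy s k) ≡ rotBy s (rotBy r k)
rotBy-comm r s k = begin
  rotBy r (rotBy s k)          ≡⟨ trans (rotBy-iter r _) (cong (iter r rot1) (rotBy-iter s k)) ⟩
  iter r rot1 (iter s rot1 k)  ≡⟨ iter-+ rot1 r s k ⟨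
  iter (r + s) rot1 k          ≡⟨ cong (λ t → iter t rot1 k) (+-comm r s) ⟩
  iter (s + r) rot1 k          ≡⟨ iter-+ rot1 s r k ⟩
  iter s rot1 (iter r rot1 k)  ≡⟨ trans (rotBy-iter s _) (cong (iter s rot1) (rotBy-iter r k)) ⟨
  rotBy s (rotBy r k)          ∎
  where open ≡-Reasoning

-- turning by 3r after r is a full number of turns
rotBy-inverse : ∀ r k → rotBy (3 * r) (rotBy r k) ≡ k
rotBy-inverse r k = begin
  rotBy (3 * r) (rotBy r k)         ≡⟨ trans (rotBy-iter (3 * r) _) (cong (iter (3 * r) rot1) (rotBy-iter r k)) ⟩
  iter (3 * r) rot1 (iter r rot1 k) ≡⟨ iter-+ rot1 (3 * r) r k ⟨
  iter (3 * r + r) rot1 k           ≡⟨ cong (λ t → iter t rot1 k) (trans (+-comm (3 * r) r) (*-comm 4 r)) ⟩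
  iter (r * 4) rot1 k               ≡⟨ iter-period rot1 4 (rot1-order4 k) r ⟩
  k                                 ∎
  where open ≡-Reasoning

rot1-injective : ∀ k l → rot1 k ≡ rot1 l → k ≡ l
rot1-injective k l e = trans (sym (rot1-order4 k)) (trans (cong (iter 3 rot1) e) (rot1-order4 l))

σ-injective : ∀ {N} (x y : Dart N) → σ x ≡ σ y → x ≡ y
σ-injective (v , k) (w , l) e = cong₂ _,_ (cong proj₁ e) (rot1-injective k l (cong proj₂ e))

dartCode : ∀ {N} → Dart N → Fin (N * 4)
dartCode (v , k) = combine v k

idx-dartCode : ∀ {N} (d : Dart N) → idx d ≡ toℕ (dartCode d)
idx-dartCode (v , k) = trans (cong (_+ toℕ k) (*-comm (toℕ v) 4)) (sym (toℕ-combine v k))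

dartCode-injective : ∀ {N} (x y : Dart N) → dartCode x ≡ dartCode y → x ≡ y
dartCode-injective (v , k) (w , l) e with combine-injective v k w l e
... | refl , refl = refl

idx-injective : ∀ {N} (x y : Dart N) → idx x ≡ idx y → x ≡ y
idx-injective x y e = dartCode-injective x y
  (toℕ-injective (trans (sym (idx-dartCode x)) (trans e (idx-dartCode y))))

module _ {N : ℕ} (D : Diagram N) (α-invol : ∀ d → α D (α D d) ≡ d) where

  faceStep-injective : ∀ x y → faceStep D x ≡ faceStep D y → x ≡ y
  faceStep-injective x y e =
    trans (sym (α-invol x)) (trans (cong (α D) (σ-injective _ _ e)) (α-invol y))

  faceStep-periodic : ∀ d → ∃[ p ] (1 ≤ p × p ≤ 4 * N × iter p (faceStep D) d ≡ d)
  faceStep-periodic d with periodic dartCode dartCode-injective (faceStep D) faceStep-injective d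
  ... | p , 1≤p , p≤N*4 , back = p , 1≤p , subst (p ≤_) (*-comm N 4) p≤N*4 , back

allB-ext : {A : Set} {p q : A → Bool} (xs : List A) →
  (∀ x → p x ≡ q x) → allB p xs ≡ allB q xs
allB-ext []       e = refl
allB-ext (x ∷ xs) e = cong₂ _∧_ (e x) (allB-ext xs e)

record DartIso {N : ℕ} (D D' : Diagram N) : Set where
  field
    to from : Dart N → Dart N
    from-to : ∀ d → from (to d) ≡ d
    to-from : ∀ e → to (from e) ≡ e
    to-σ    : ∀ d → to (σ d) ≡ σ (to d)
    to-α    : ∀ d → α D' (to d) ≡ to (α D d)

  to-injective : ∀ x y → to x ≡ to y → x ≡ y
  to-injective x y e = trans (sym (from-to x)) (trans (cong from e) (from-to y))

  -- going straight through a crossing is two quarter turns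
  to-opp : ∀ d → to (opp d) ≡ opp (to d)
  to-opp d = trans (to-σ (σ d)) (cong σ (to-σ d))

  to-faceStep : ∀ d → to (faceStep D d) ≡ faceStep D' (to d)
  to-faceStep d = trans (to-σ (α D d)) (cong σ (sym (to-α d)))

  to-strandStep : ∀ d → to (strandStep D d) ≡ strandStep D' (to d)
  to-strandStep d = trans (to-opp (α D d)) (cong opp (sym (to-α d)))

dartIso-sym : ∀ {N} {D D' : Diagram N} → DartIso D D' → DartIso D' D
dartIso-sym {D = D} {D'} φ = record
  { to = from ; from = to ; from-to = to-from ; to-from = from-to
  ; to-σ = λ e → to-injective _ _ (trans (to-from (σ e))
                   (trans (cong σ (sym (to-from e))) (sym (to-σ (from e)))))
  ; to-α = λ e → to-injective _ _ (trans (sym (to-α (from e)))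
                   (trans (cong (α D') (to-from e)) (sym (to-from (α D' e))))) }
  where open DartIso φ

iso⇒dartIso : ∀ {N} {D D' : Diagram N} → Iso D D' → DartIso D D'
iso⇒dartIso {N} I = record
  { to = mapD ; from = unmap ; from-to = unmap-map ; to-from = map-unmap
  ; to-σ = λ { (v , k) → cong (π ⟨$⟩ʳ v ,_) (rotBy-comm (toℕ (rot v)) 1 k) }
  ; to-α = α-hom }
  where
  open Iso I
  unmap : Dart N → Dart N
  unmap (w , l) = π ⟨$⟩ˡ w , rotBy (3 * toℕ (rot (π ⟨$⟩ˡ w))) l
  unmap-map : ∀ d → unmap (mapD d) ≡ d
  unmap-map (v , k) rewrite inverseˡ π {v} = cong (v ,_) (rotBy-inverse (toℕ (rot v)) k)
  map-unmap : ∀ e → mapD (unmap e) ≡ e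
  map-unmap (w , l) rewrite inverseʳ π {w} = cong (w ,_)
    (trans (rotBy-comm r (3 * r) l) (rotBy-inverse r l))
    where r = toℕ (rot (π ⟨$⟩ˡ w))

planar-transfer : ∀ {N} (D D' : Diagram N) → faceCount D' ≡ faceCount D → Planar D → Planar D'
planar-transfer {zero}  D D' same planar = tt
planar-transfer {suc N} D D' same planar = trans same planar

-- For planarity, the faces of D' pulled back along `to` are
-- the faces of D, counted by representatives for the key idx ∘ to instead of
-- idx; by `repCount` the choice of key does not matter.
module _ {N : ℕ} {D D' : Diagram N} (φ : DartIso D D') where
  open DartIso φ

  faceCount-dartIso : (∀ d → α D (α D d) ≡ d) → faceCount D' ≡ faceCount D
  faceCount-dartIso α-invol = begin
    faceCount D'                                 ≡⟨ countB-permute (dartListing N) to from from-to to-from (isFaceRep D') ⟨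
    countB (λ d → isFaceRep D' (to d)) (darts N) ≡⟨ countB-ext (darts N) pulled-back ⟩
    countB (isRep (λ d → idx (to d))) (darts N)  ≡⟨ repCount (dartListing N) _ idx idx∘to-injective idx-injective ⟩
    faceCount D                                  ∎
    where
    open ≡-Reasoning
    open Orbits (faceStep D) (4 * N) (faceStep-periodic D α-invol)
    pulled-back : ∀ d → isFaceRep D' (to d) ≡ isRep (λ x → idx (to x)) d
    pulled-back d = allB-ext (upTo (4 * N)) (λ j →
      cong (λ e → idx (to d) ≤ᵇ idx e) (sym (iter-conj to to-faceStep j d)))
    idx∘to-injective : ∀ x y → idx (to x) ≡ idx (to y) → x ≡ y
    idx∘to-injective x y e = to-injective x y (idx-injective _ _ e)

  wf-dartIso : WF D → WF D'
  wf-dartIso (α-invol , α-fpf , knot , planar) =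
    α-invol' , α-fpf' , knot' , planar-transfer D D' (faceCount-dartIso α-invol) planar
    where
    α-invol' : ∀ e → α D' (α D' e) ≡ e
    α-invol' e = begin
      α D' (α D' e)                 ≡⟨ cong (λ x → α D' (α D' x)) (to-from e) ⟨
      α D' (α D' (to (from e)))     ≡⟨ cong (α D') (to-α (from e)) ⟩
      α D' (to (α D (from e)))      ≡⟨ to-α _ ⟩
      to (α D (α D (from e)))       ≡⟨ cong to (α-invol (from e)) ⟩
      to (from e)                   ≡⟨ to-from e ⟩
      e                             ∎
      where open ≡-Reasoning
    α-fpf' : ∀ e → ¬ (α D' e ≡ e)
    α-fpf' e loop = α-fpf (from e) (to-injective _ _ (begin
      to (α D (from e))   ≡⟨ to-α (from e) ⟨
      α D' (to (from e))  ≡⟨ cong (α D') (to-from e) ⟩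
      α D' e              ≡⟨ loop ⟩
      e                   ≡⟨ to-from e ⟨
      to (from e)         ∎))
      where open ≡-Reasoning
    walk : ∀ j d → iter j (strandStep D') d ≡ to (iter j (strandStep D) (from d))
    walk j d = trans (cong (iter j (strandStep D')) (sym (to-from d)))
                     (sym (iter-conj to to-strandStep j (from d)))
    knot' : IsKnot D'
    knot' d e with knot (from d) (from e)
    ... | j , inj₁ p = j , inj₁ (trans (walk j d) (trans (cong to p) (to-from e)))
    ... | j , inj₂ p = j , inj₂ (trans (walk j d) (trans (cong to p)
                                  (trans (sym (to-α (from e))) (cong (α D') (to-from e)))))

-- Resolving crossings does not touch the underlying map.
wf-resolve : ∀ {N} (E : Diagram N) v b → WF E → WF (resolve E v b)
wf-resolve {zero}  E v b wf = wf
wf-resolve {suc N} E v b wf = wf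

-- An isotopy E ≅ E' matches crossing v of E
-- with π v of E' (turned by rot v), so it matches the unresolved crossings,
-- and resolving v to b corresponds to resolving π v to b xor oddF (rot v).
module _ {N : ℕ} {E E' : Diagram N} (I : Iso E E') where
  open Iso I

  π-injective : ∀ v w → π ⟨$⟩ʳ v ≡ π ⟨$⟩ʳ w → v ≡ w
  π-injective v w e = trans (sym (inverseˡ π)) (trans (cong (π ⟨$⟩ˡ_) e) (inverseˡ π))

  turned : Fin N → Bool → Bool
  turned v b = b xor oddF (rot v)

  resolve-iso : ∀ v b → Iso (resolve E v b) (resolve E' (π ⟨$⟩ʳ v) (turned v b))
  resolve-iso v b = record { π = π ; rot = rot ; α-hom = α-hom ; st-hom = st-hom' }
    where
    st-hom' : ∀ w → st (resolve E' (π ⟨$⟩ʳ v) (turned v b)) (π ⟨$⟩ʳ w)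
                    ≡ rotSt (rot w) (st (resolve E v b) w)
    st-hom' w with w ≟ v
    ... | yes refl with π ⟨$⟩ʳ w ≟ π ⟨$⟩ʳ w
    ...   | yes _      = refl
    ...   | no πw≢πw   = ⊥-elim (πw≢πw refl)
    st-hom' w | no w≢v with π ⟨$⟩ʳ w ≟ π ⟨$⟩ʳ v
    ...   | yes e = ⊥-elim (w≢v (π-injective w v e))
    ...   | no _  = st-hom w

  resolve-iso⁻ : ∀ v' b' →
    Iso (resolve E (π ⟨$⟩ˡ v') (turned (π ⟨$⟩ˡ v') b')) (resolve E' v' b')
  resolve-iso⁻ v' b' = subst₂ (λ w c → Iso (resolve E v (turned v b')) (resolve E' w c))
    (inverseʳ π) (xor-cancelʳ b' (oddF (rot v))) (resolve-iso v (turned v b'))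
    where
    v : Fin N
    v = π ⟨$⟩ˡ v'
    xor-cancelʳ : ∀ b c → (b xor c) xor c ≡ b
    xor-cancelʳ b c = trans (xor-assoc b c c) (trans (cong (b xor_) (xor-same c)) (xor-identityʳ b))

  unres→ : ∀ v → st E v ≡ unres → st E' (π ⟨$⟩ʳ v) ≡ unres
  unres→ v e = trans (st-hom v) (cong (rotSt (rot v)) e)

  unres← : ∀ v' → st E' v' ≡ unres → st E (π ⟨$⟩ˡ v') ≡ unres
  unres← v' e = rotSt-unres (rot (π ⟨$⟩ˡ v')) (st E (π ⟨$⟩ˡ v'))
    (trans (sym (st-hom (π ⟨$⟩ˡ v'))) (trans (cong (st E') (inverseʳ π)) e))
    where
    rotSt-unres : ∀ r s → rotSt r s ≡ unres → s ≡ unres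
    rotSt-unres r unres _ = refl

  allResolved← : AllResolved E' → AllResolved E
  allResolved← all v = resolved (st E v) (subst IsResolved (st-hom v) (all (π ⟨$⟩ʳ v)))
    where
    resolved : ∀ s → IsResolved (rotSt (rot v) s) → IsResolved s
    resolved (res b) _ = b , refl

  allResolved→ : AllResolved E → AllResolved E'
  allResolved→ all v' = subst IsResolved (trans (sym (st-hom (π ⟨$⟩ˡ v'))) (cong (st E') (inverseʳ π)))
    (turn (all (π ⟨$⟩ˡ v')))
    where
    turn : ∀ {s} → IsResolved s → IsResolved (rotSt (rot (π ⟨$⟩ˡ v')) s)
    turn (b , refl) = _ , refl

  -- isotopic diagrams are unknots together (an isotopy is a Reidemeister step)
  unknot← : WF E → WF E' → IsUnknot E' → IsUnknot E
  unknot← wf wf' (all , path) = allResolved← all , fwd (iso wf wf' I) ◅ path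

  unknot→ : WF E → WF E' → IsUnknot E → IsUnknot E'
  unknot→ wf wf' (all , path) = allResolved→ all , bwd (iso wf wf' I) ◅ path

  unresCount-iso : unresCount E ≡ unresCount E'
  unresCount-iso = trans (countB-ext (allFin N) same) (countB-permute (finListing N) (π ⟨$⟩ʳ_) (π ⟨$⟩ˡ_)
                     (λ v → inverseˡ π) (λ v' → inverseʳ π) (λ v' → isUnres (st E' v')))
    where
    same : ∀ v → isUnres (st E v) ≡ isUnres (st E' (π ⟨$⟩ʳ v))
    same v = trans (isUnres-turn (rot v) (st E v)) (cong isUnres (sym (st-hom v)))
      where
      isUnres-turn : ∀ r s → isUnres s ≡ isUnres (rotSt r s)
      isUnres-turn r unres   = refl
      isUnres-turn r (res b) = refl

iso-UWins : ∀ {N p} {E E' : Diagram N} → WF E → WF E' → Iso E E' → UWins p E' → UWins p E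
iso-UWins wf wf' I (done all unknot) = done (allResolved← I all) (unknot← I wf wf' unknot)
iso-UWins {E = E} {E'} wf wf' I (uMove v' b' u t) =
  uMove (π ⟨$⟩ˡ v') (turned I (π ⟨$⟩ˡ v') b') (unres← I v' u)
    (iso-UWins (wf-resolve E _ _ wf) (wf-resolve E' v' b' wf') (resolve-iso⁻ I v' b') t)
  where open Iso I
iso-UWins {E = E} {E'} wf wf' I (kMove (v' , u) strat) = kMove (π ⟨$⟩ˡ v' , unres← I v' u) λ v b u →
  iso-UWins (wf-resolve E v b wf) (wf-resolve E' _ _ wf') (resolve-iso I v b)
    (strat (π ⟨$⟩ʳ v) (turned I v b) (unres→ I v u))
  where open Iso I

iso-KWins : ∀ {N p} {E E' : Diagram N} → WF E → WF E' → Iso E E' → KWins p E' → KWins p E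
iso-KWins wf wf' I (done all knotted) = done (allResolved← I all) (λ u → knotted (unknot→ I wf wf' u))
iso-KWins {E = E} {E'} wf wf' I (kMove v' b' u t) =
  kMove (π ⟨$⟩ˡ v') (turned I (π ⟨$⟩ˡ v') b') (unres← I v' u)
    (iso-KWins (wf-resolve E _ _ wf) (wf-resolve E' v' b' wf') (resolve-iso⁻ I v' b') t)
  where open Iso I
iso-KWins {E = E} {E'} wf wf' I (uMove (v' , u) strat) = uMove (π ⟨$⟩ˡ v' , unres← I v' u) λ v b u →
  iso-KWins (wf-resolve E v b wf) (wf-resolve E' _ _ wf') (resolve-iso I v b)
    (strat (π ⟨$⟩ʳ v) (turned I v b) (unres→ I v u))
  where open Iso I

isEven : ℕ → Bool
isEven zero    = true
isEven (suc n) = not (isEven n)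

isEven-%2 : ∀ n → n % 2 ≡ (if isEven n then 0 else 1)
isEven-%2 zero          = refl
isEven-%2 (suc zero)    = refl
isEven-%2 (suc (suc n)) =
  trans (isEven-%2 n) (cong (λ b → if b then 0 else 1) (sym (not-involutive (isEven n))))

even⇒isEven : ∀ n → n % 2 ≡ 0 → isEven n ≡ true
even⇒isEven n e with isEven n | isEven-%2 n
... | true  | _  = refl
... | false | e' with trans (sym e') e
...   | ()

odd⇒isEven : ∀ n → n % 2 ≡ 1 → isEven n ≡ false
odd⇒isEven n e with isEven n | isEven-%2 n
... | false | _  = refl
... | true  | e' with trans (sym e') e
...   | ()

unresCount-resolve : ∀ {n} (F : Diagram n) v b → st F v ≡ unres →
  unresCount F ≡ suc (unresCount (resolve F v b))
unresCount-resolve {n} F v b u =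
  trans (countB-remove (finListing n) (λ w → isUnres (st F w)) v (cong isUnres u))
        (cong suc (countB-ext (allFin n) resolved-at-v))
  where
  resolved-at-v : ∀ w → (isUnres (st F w) ∧ not ⌊ w ≟ v ⌋) ≡ isUnres (st (resolve F v b) w)
  resolved-at-v w with ⌊ w ≟ v ⌋
  ... | true  = ∧-zeroʳ _
  ... | false = ∧-identityʳ _

unresCount-allResolved : ∀ {n} (F : Diagram n) → AllResolved F → unresCount F ≡ 0
unresCount-allResolved {n} F all = countB-none (allFin n) (λ v → resolved (all v))
  where
  resolved : ∀ {s} → IsResolved s → isUnres s ≡ false
  resolved (b , refl) = refl

other : Player → Player
other unknotter = knotter
other knotter   = unknotter

_==ᴾ_ : Player → Player → Bool
unknotter ==ᴾ unknotter = true
knotter   ==ᴾ knotter   = true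
_         ==ᴾ _         = false

==ᴾ-other : ∀ p q → (other p ==ᴾ q) ≡ not (p ==ᴾ q)
==ᴾ-other unknotter unknotter = refl
==ᴾ-other unknotter knotter   = refl
==ᴾ-other knotter   unknotter = refl
==ᴾ-other knotter   knotter   = refl

-- With p to move in F, player q moves exactly when an even number of
-- crossings is unresolved.  Moves preserve this, since each one resolves a
-- crossing and passes the turn.
EvenTurn : Player → Player → ∀ {n} → Diagram n → Set
EvenTurn q p F = isEven (unresCount F) ≡ (p ==ᴾ q)

evenTurn-move : ∀ q p {n} (F : Diagram n) v b → st F v ≡ unres →
  EvenTurn q p F → EvenTurn q (other p) (resolve F v b)
evenTurn-move q p F v b u turn = begin
  isEven (unresCount (resolve F v b))             ≡⟨ not-involutive _ ⟨
  not (isEven (suc (unresCount (resolve F v b)))) ≡⟨ cong (λ m → not (isEven m)) (unresCount-resolve F v b u) ⟨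
  not (isEven (unresCount F))                     ≡⟨ cong not turn ⟩
  not (p ==ᴾ q)                                   ≡⟨ ==ᴾ-other p q ⟨
  other p ==ᴾ q                                   ∎
  where open ≡-Reasoning

evenTurn-over : ∀ q p {n} (F : Diagram n) → AllResolved F → EvenTurn q p F → (p ==ᴾ q) ≡ true
evenTurn-over q p F all turn = trans (sym turn) (cong isEven (unresCount-allResolved F all))

-- F arises from E by deleting the bigon on crossings 0 and 1;
-- the outside crossings suc (suc v) of E are the crossings v of F.
record BigonRemoval {n : ℕ} (E : Diagram (2 + n)) (F : Diagram n) : Set where
  field
    wf-E     : WF E
    wf-F     : WF F
    bigon    : Bigon E
    rerouted : ∀ d → embD {2} {n} (α F d)
                     ≡ reroute {2} {n} (liftG {2} {n} partnerR2) (α E) (α E (embD {2} {n} d))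
open BigonRemoval

removal-resolveᴱ : ∀ {n} {E : Diagram (2 + n)} {F : Diagram n} →
  BigonRemoval E F → ∀ u b → BigonRemoval (resolve E u b) F
removal-resolveᴱ {E = E} R u b = record
  { wf-E = wf-resolve E u b (wf-E R) ; wf-F = wf-F R ; bigon = bigon R ; rerouted = rerouted R }

removal-resolveᶠ : ∀ {n} {E : Diagram (2 + n)} {F : Diagram n} →
  BigonRemoval E F → ∀ v b → BigonRemoval E (resolve F v b)
removal-resolveᶠ {F = F} R v b = record
  { wf-E = wf-E R ; wf-F = wf-resolve F v b (wf-F R) ; bigon = bigon R ; rerouted = rerouted R }

Outside : ∀ {n} → Diagram (2 + n) → Diagram n → Set
Outside E F = ∀ v → st F v ≡ st E (suc (suc v))

outside-resolve : ∀ {n} {E : Diagram (2 + n)} {F : Diagram n} →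
  Outside E F → ∀ v b → Outside (resolve E (suc (suc v)) b) (resolve F v b)
outside-resolve out v b w rewrite ≟-suc (suc w) (suc v) | ≟-suc w v with ⌊ w ≟ v ⌋
... | true  = refl
... | false = out w

Unresolved : ∀ {n} → Diagram (2 + n) → Set
Unresolved E = st E zero ≡ unres × st E (suc zero) ≡ unres

Classical : ∀ {n} → Diagram (2 + n) → Set
Classical E = (st E zero ≡ res true × st E (suc zero) ≡ res false)
              ⊎ (st E zero ≡ res false × st E (suc zero) ≡ res true)

classical-close₀ : ∀ {n} (E : Diagram (2 + n)) b → Classical (resolve (resolve E zero b) (suc zero) (not b))
classical-close₀ E true  = inj₁ (refl , refl)
classical-close₀ E false = inj₂ (refl , refl)

classical-close₁ : ∀ {n} (E : Diagram (2 + n)) b → Classical (resolve (resolve E (suc zero) b) zero (not b))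
classical-close₁ E true  = inj₂ (refl , refl)
classical-close₁ E false = inj₁ (refl , refl)

resolved≢unres : ∀ {s} → IsResolved s → ¬ (s ≡ unres)
resolved≢unres (b , refl) ()

classical-resolved₀ : ∀ {n} {E : Diagram (2 + n)} → Classical E → IsResolved (st E zero)
classical-resolved₀ (inj₁ (e , _)) = true , e
classical-resolved₀ (inj₂ (e , _)) = false , e

classical-resolved₁ : ∀ {n} {E : Diagram (2 + n)} → Classical E → IsResolved (st E (suc zero))
classical-resolved₁ (inj₁ (_ , e)) = false , e
classical-resolved₁ (inj₂ (_ , e)) = true , e

module _ {n : ℕ} {E : Diagram (2 + n)} {F : Diagram n}
         (R : BigonRemoval E F) (out : Outside E F) (cl : Classical E) where

  r2-step : Step (2 + n , E) (n , F)
  r2-step = r2 (wf-E R) (wf-F R) (bigon R , cl , rerouted R , out)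

  allResolved-lift : AllResolved F → AllResolved E
  allResolved-lift all zero          = classical-resolved₀ {E = E} cl
  allResolved-lift all (suc zero)    = classical-resolved₁ {E = E} cl
  allResolved-lift all (suc (suc v)) = subst IsResolved (out v) (all v)

  unknot-lift : IsUnknot F → IsUnknot E
  unknot-lift (all , path) = allResolved-lift all , fwd r2-step ◅ path

  unknot-drop : IsUnknot E → IsUnknot F
  unknot-drop (all , path) = (λ v → subst IsResolved (sym (out v)) (all (suc (suc v)))) , bwd r2-step ◅ path

-- Once the bigon is closed classically, E is played exactly like F: every
-- unresolved crossing of E lies outside the bigon, and the classical
-- bigon is removed by a Reidemeister II move at the end.
closed-UWins : ∀ {n p} {E : Diagram (2 + n)} {F : Diagram n} →
  BigonRemoval E F → Outside E F → Classical E → UWins p F → UWins p E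
closed-UWins R out cl (done all unknot) = done (allResolved-lift R out cl all) (unknot-lift R out cl unknot)
closed-UWins {E = E} {F} R out cl (uMove v b u t) = uMove (suc (suc v)) b (trans (sym (out v)) u)
  (closed-UWins (removal-resolveᶠ (removal-resolveᴱ R (suc (suc v)) b) v b) (outside-resolve {E = E} {F} out v b) cl t)
closed-UWins {E = E} {F} R out cl (kMove (v , u) strat) = kMove (suc (suc v) , trans (sym (out v)) u) reply
  where
  reply : ∀ w b → st E w ≡ unres → UWins unknotter (resolve E w b)
  reply zero          b u = ⊥-elim (resolved≢unres (classical-resolved₀ {E = E} cl) u)
  reply (suc zero)    b u = ⊥-elim (resolved≢unres (classical-resolved₁ {E = E} cl) u)
  reply (suc (suc w)) b u = closed-UWins (removal-resolveᶠ (removal-resolveᴱ R (suc (suc w)) b) w b)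
    (outside-resolve {E = E} {F} out w b) cl (strat w b (trans (out w) u))

closed-KWins : ∀ {n p} {E : Diagram (2 + n)} {F : Diagram n} →
  BigonRemoval E F → Outside E F → Classical E → KWins p F → KWins p E
closed-KWins R out cl (done all knotted) =
  done (allResolved-lift R out cl all) (λ unknot → knotted (unknot-drop R out cl unknot))
closed-KWins {E = E} {F} R out cl (kMove v b u t) = kMove (suc (suc v)) b (trans (sym (out v)) u)
  (closed-KWins (removal-resolveᶠ (removal-resolveᴱ R (suc (suc v)) b) v b) (outside-resolve {E = E} {F} out v b) cl t)
closed-KWins {E = E} {F} R out cl (uMove (v , u) strat) = uMove (suc (suc v) , trans (sym (out v)) u) reply
  where
  reply : ∀ w b → st E w ≡ unres → KWins knotter (resolve E w b)
  reply zero          b u = ⊥-elim (resolved≢unres (classical-resolved₀ {E = E} cl) u)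
  reply (suc zero)    b u = ⊥-elim (resolved≢unres (classical-resolved₁ {E = E} cl) u)
  reply (suc (suc w)) b u = closed-KWins (removal-resolveᶠ (removal-resolveᴱ R (suc (suc w)) b) w b)
    (outside-resolve {E = E} {F} out w b) cl (strat w b (trans (out w) u))

-- In an unresolved bigon, a move on one bigon crossing is answered by
-- resolving the other one oppositely; this closes the bigon classically
-- and the game continues as in F with the same player to move.
module _ {n : ℕ} {E : Diagram (2 + n)} {F : Diagram n}
         (R : BigonRemoval E F) (out : Outside E F) (un : Unresolved E) where

  closed₀ : ∀ b → BigonRemoval (resolve (resolve E zero b) (suc zero) (not b)) F
  closed₀ b = removal-resolveᴱ (removal-resolveᴱ R zero b) (suc zero) (not b)

  closed₁ : ∀ b → BigonRemoval (resolve (resolve E (suc zero) b) zero (not b)) F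
  closed₁ b = removal-resolveᴱ (removal-resolveᴱ R (suc zero) b) zero (not b)

  answer-U₀ : UWins knotter F → ∀ b → UWins unknotter (resolve E zero b)
  answer-U₀ t b = uMove (suc zero) (not b) (proj₂ un) (closed-UWins (closed₀ b) out (classical-close₀ E b) t)

  answer-U₁ : UWins knotter F → ∀ b → UWins unknotter (resolve E (suc zero) b)
  answer-U₁ t b = uMove zero (not b) (proj₁ un) (closed-UWins (closed₁ b) out (classical-close₁ E b) t)

  answer-K₀ : KWins unknotter F → ∀ b → KWins knotter (resolve E zero b)
  answer-K₀ t b = kMove (suc zero) (not b) (proj₂ un) (closed-KWins (closed₀ b) out (classical-close₀ E b) t)

  answer-K₁ : KWins unknotter F → ∀ b → KWins knotter (resolve E (suc zero) b)
  answer-K₁ t b = kMove zero (not b) (proj₁ un) (closed-KWins (closed₁ b) out (classical-close₁ E b) t)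

-- The Unknotter copies her F-strategy
-- outside the bigon and answers every bigon move.  By parity, when the game
-- on F is over it is the Knotter's turn, and his only moves open the bigon.
open-UWins : ∀ {n p} {E : Diagram (2 + n)} {F : Diagram n} → BigonRemoval E F → Outside E F →
  Unresolved E → EvenTurn knotter p F → UWins p F → UWins p E
open-UWins {p = knotter} {E} R out un turn t@(done all _) = kMove (zero , proj₁ un) reply
  where
  reply : ∀ w b → st E w ≡ unres → UWins unknotter (resolve E w b)
  reply zero          b _ = answer-U₀ R out un t b
  reply (suc zero)    b _ = answer-U₁ R out un t b
  reply (suc (suc w)) b u = ⊥-elim (resolved≢unres (all w) (trans (out w) u))
open-UWins {p = unknotter} {F = F} R out un turn (done all _) with evenTurn-over knotter unknotter F all turn
... | ()
open-UWins {E = E} {F} R out un turn (uMove v b u t) = uMove (suc (suc v)) b (trans (sym (out v)) u)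
  (open-UWins (removal-resolveᶠ (removal-resolveᴱ R (suc (suc v)) b) v b) (outside-resolve {E = E} {F} out v b)
     un (evenTurn-move knotter unknotter F v b u turn) t)
open-UWins {E = E} {F} R out un turn t@(kMove (v , u) strat) = kMove (suc (suc v) , trans (sym (out v)) u) reply
  where
  reply : ∀ w b → st E w ≡ unres → UWins unknotter (resolve E w b)
  reply zero          b _ = answer-U₀ R out un t b
  reply (suc zero)    b _ = answer-U₁ R out un t b
  reply (suc (suc w)) b u = open-UWins (removal-resolveᶠ (removal-resolveᴱ R (suc (suc w)) b) w b)
    (outside-resolve {E = E} {F} out w b) un (evenTurn-move knotter knotter F w b (trans (out w) u) turn)
    (strat w b (trans (out w) u))

open-KWins : ∀ {n p} {E : Diagram (2 + n)} {F : Diagram n} → BigonRemoval E F → Outside E F →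
  Unresolved E → EvenTurn unknotter p F → KWins p F → KWins p E
open-KWins {p = unknotter} {E} R out un turn t@(done all _) = uMove (zero , proj₁ un) reply
  where
  reply : ∀ w b → st E w ≡ unres → KWins knotter (resolve E w b)
  reply zero          b _ = answer-K₀ R out un t b
  reply (suc zero)    b _ = answer-K₁ R out un t b
  reply (suc (suc w)) b u = ⊥-elim (resolved≢unres (all w) (trans (out w) u))
open-KWins {p = knotter} {F = F} R out un turn (done all _) with evenTurn-over unknotter knotter F all turn
... | ()
open-KWins {E = E} {F} R out un turn (kMove v b u t) = kMove (suc (suc v)) b (trans (sym (out v)) u)
  (open-KWins (removal-resolveᶠ (removal-resolveᴱ R (suc (suc v)) b) v b) (outside-resolve {E = E} {F} out v b)
     un (evenTurn-move unknotter knotter F v b u turn) t)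
open-KWins {E = E} {F} R out un turn t@(uMove (v , u) strat) = uMove (suc (suc v) , trans (sym (out v)) u) reply
  where
  reply : ∀ w b → st E w ≡ unres → KWins knotter (resolve E w b)
  reply zero          b _ = answer-K₀ R out un t b
  reply (suc zero)    b _ = answer-K₁ R out un t b
  reply (suc (suc w)) b u = open-KWins (removal-resolveᶠ (removal-resolveᴱ R (suc (suc w)) b) w b)
    (outside-resolve {E = E} {F} out w b) un (evenTurn-move unknotter unknotter F w b (trans (out w) u) turn)
    (strat w b (trans (out w) u))

evenTurn-even : ∀ q {n} (F : Diagram n) → Even F → EvenTurn q q F
evenTurn-even unknotter F even = even⇒isEven (unresCount F) even
evenTurn-even knotter   F even = even⇒isEven (unresCount F) even

evenTurn-odd : ∀ q {n} (F : Diagram n) → Odd F → EvenTurn q (other q) F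
evenTurn-odd unknotter F odd = odd⇒isEven (unresCount F) odd
evenTurn-odd knotter   F odd = odd⇒isEven (unresCount F) odd

module PseudoR2 {n : ℕ} {P P₀ : Diagram (2 + n)} {Q Q₀ : Diagram n}
  (wf-P : WF P) (wf-Q : WF Q) (P≅P₀ : Iso P P₀) (move : PR2 P₀ Q₀) (Q₀≅Q : Iso Q₀ Q) where

  wf-P₀ : WF P₀
  wf-P₀ = wf-dartIso (iso⇒dartIso P≅P₀) wf-P

  wf-Q₀ : WF Q₀
  wf-Q₀ = wf-dartIso (dartIso-sym (iso⇒dartIso Q₀≅Q)) wf-Q

  removal : BigonRemoval P₀ Q₀
  removal = record { wf-E = wf-P₀ ; wf-F = wf-Q₀ ; bigon = proj₁ move
                   ; rerouted = proj₁ (proj₂ (proj₂ (proj₂ move))) }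

  outside : Outside P₀ Q₀
  outside = proj₂ (proj₂ (proj₂ (proj₂ move)))

  unresolved : Unresolved P₀
  unresolved = proj₁ (proj₂ move) , proj₁ (proj₂ (proj₂ move))

  turn₀ : ∀ q p → EvenTurn q p Q → EvenTurn q p Q₀
  turn₀ q p turn = trans (cong isEven (unresCount-iso Q₀≅Q)) turn

  transfer-U : ∀ p → EvenTurn knotter p Q → UWins p Q → UWins p P
  transfer-U p turn win = iso-UWins wf-P wf-P₀ P≅P₀
    (open-UWins removal outside unresolved (turn₀ knotter p turn) (iso-UWins wf-Q₀ wf-Q Q₀≅Q win))

  transfer-K : ∀ p → EvenTurn unknotter p Q → KWins p Q → KWins p P
  transfer-K p turn win = iso-KWins wf-P wf-P₀ P≅P₀
    (open-KWins removal outside unresolved (turn₀ unknotter p turn) (iso-KWins wf-Q₀ wf-Q Q₀≅Q win))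

-- Lemma 3.9.
lemma3p9 : ∀ {n} (P : Diagram (2 + n)) (Q : Diagram n) → P ⟶² Q →
    ((Even P → Even Q → (U2 Q → U2 P) × (K2 Q → K2 P))
     × (Odd P → Odd Q → (U1 Q → U1 P) × (K1 Q → K1 P)))
lemma3p9 P Q (wf-P , wf-Q , P₀ , Q₀ , P≅P₀ , move , Q₀≅Q) =
  (λ _ even → transfer-U knotter (evenTurn-even knotter Q even)
            , transfer-K unknotter (evenTurn-even unknotter Q even))
  , (λ _ odd → transfer-U unknotter (evenTurn-odd knotter Q odd)
             , transfer-K knotter (evenTurn-odd unknotter Q odd))
  where open PseudoR2 wf-P wf-Q P≅P₀ move Q₀≅Q
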